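{- For any integers $k,m\ge 2$, $$h(C_{2k+1}\boxtimes P_m)=\begin{cases}2,&\text{if } k\le m-2,\\ 3,&\text{if } k\ge m-1.\end{cases}$$
   Context: $C_{2k+1}$ is the cycle of order $2k+1$ and $P_m$ the path of order $m$. For a connected graph, $I[x,y]$ consists of $x$, $y$ and all vertices on some shortest $x$–$y$ path; $I[S]=\bigcup_{u,v\in S}I[u,v]$. $S$ is convex if $I[S]=S$; $CH(S)$ is the smallest convex set containing $S$; $S$ is a hull set if $CH(S)$ is the whole vertex set, and $h(\cdot)$ is the minimum size of a hull set. The strong product $G\boxtimes H$ has vertex set $V(G)\times V(H)$, with $(g,h)$ and $(g',h')$ adjacent whenever ($g=g'$ and $hh'\in E(H)$), or ($h=h'$ and $gg'\in E(G)$), or ($gg'\in E(G)$ and $hh'\in E(H)$). -}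

module Defs where

open import Level using (0ℓ)
open import Data.Nat using (ℕ; zero; suc; _+_; _≤_; _%_; NonZero)
open import Data.Fin using (Fin; toℕ)
open import Data.Product using (Σ; _×_; _,_; ∃)
open import Data.Sum using (_⊎_)
open import Data.List using (List; length)
open import Data.List.Membership.Propositional using (_∈_)
open import Data.List.Relation.Unary.Unique.Propositional using (Unique)
open import Relation.Binary.PropositionalEquality using (_≡_)

record Graph : Set₁ where
  field
    V : Set
    E : V → V → Set
open Graph public

module _ (G : Graph) where

  data Walk : V G → V G → Set where
    nil  : ∀ x → Walk x x
    cons : ∀ {x y z} → E G x y → Walk y z → Walk x z

  wlen : ∀ {x y} → Walk x y → ℕ
  wlen (nil _)    = 0
  wlen (cons _ w) = suc (wlen w)

  data OnWalk (v : V G) : ∀ {x y} → Walk x y → Set where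
    here-nil  : OnWalk v (nil v)
    here-cons : ∀ {y z} (e : E G v y) (w : Walk y z) → OnWalk v (cons e w)
    there     : ∀ {x y z} (e : E G x y) (w : Walk y z) → OnWalk v w → OnWalk v (cons e w)

  Shortest : ∀ {x y} → Walk x y → Set
  Shortest {x} {y} w = (w′ : Walk x y) → wlen w ≤ wlen w′

  Interval : V G → V G → V G → Set
  Interval x y z = z ≡ x ⊎ z ≡ y ⊎ Σ (Walk x y) (λ w → Shortest w × OnWalk z w)

  VSet : Set₁
  VSet = V G → Set

  _⊆_ : VSet → VSet → Set
  S ⊆ T = ∀ v → S v → T v

  IntervalSet : VSet → VSet
  IntervalSet S z = Σ (V G) λ u → Σ (V G) λ v → S u × S v × Interval u v z

  -- S is convex iff I[S] = S (S ⊆ I[S] always holds)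
  Convex : VSet → Set
  Convex S = IntervalSet S ⊆ S

  -- convex hull: smallest convex set containing S (intersection of all convex supersets)
  CH : VSet → V G → Set₁
  CH S v = (T : VSet) → Convex T → S ⊆ T → T v

  ⟦_⟧ : List (V G) → VSet
  ⟦ xs ⟧ v = v ∈ xs

  IsHullSet : List (V G) → Set₁
  IsHullSet S = ∀ v → CH ⟦ S ⟧ v

  HullNumber : ℕ → Set₁
  HullNumber n =
    Σ (List (V G)) (λ S → Unique S × length S ≡ n × IsHullSet S)
    × ((S : List (V G)) → Unique S → IsHullSet S → n ≤ length S)

-- cycle C_n on Fin n (n ≥ 3 in use): i ~ j iff j ≡ i+1 mod n or i ≡ j+1 mod n
CycleAdj : (n : ℕ) .{{_ : NonZero n}} → Fin n → Fin n → Set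
CycleAdj n i j = suc (toℕ i) % n ≡ toℕ j ⊎ suc (toℕ j) % n ≡ toℕ i

Cycle : (n : ℕ) .{{_ : NonZero n}} → Graph
Cycle n = record { V = Fin n ; E = CycleAdj n }

PathAdj : (m : ℕ) → Fin m → Fin m → Set
PathAdj m i j = suc (toℕ i) ≡ toℕ j ⊎ suc (toℕ j) ≡ toℕ i

Path : ℕ → Graph
Path m = record { V = Fin m ; E = PathAdj m }

_⊠_ : Graph → Graph → Graph
G ⊠ H = record
  { V = V G × V H
  ; E = λ { (g , h) (g′ , h′) →
        (g ≡ g′ × E H h h′) ⊎ (h ≡ h′ × E G g g′) ⊎ (E G g g′ × E H h h′) } }

module Submission where

-- A graph metric (vanishing on the diagonal, 1-Lipschitz along edges, realised by
-- walks) characterises intervals: z ∈ I[u,v] iff d u z + d z v ≤ d u v.  Paths and cycles are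
-- metric, and the strong product carries the maximum of the two metrics.  A vertex lies between its two cycle neighbours in any adjacent row, so a
-- convex set containing a full row is everything.  The vertices 0, k, k+1 of a row span that
-- row; if k + 2 ≤ m the corners (0, first row) and (k, last row) span, row by row, a cone
-- whose row k is full.  Empty and one-vertex sets are convex.  If m ≤ k + 1, cut the cycle open with
-- x in the middle: the box spanned by x and y in the diagonal coordinates σ + j, σ + (m-1-j)
-- is convex, because a geodesic that wraps around the cycle is too long, but it misses a
-- vertex, since 0, k, k+1 cannot sit isometrically on a line.

open import Defs
open import Data.Nat using (ℕ; zero; suc; _+_; _*_; _∸_; _≤_; _<_; _⊔_; _⊓_; ∣_-_∣; z≤n; s≤s; _<?_; _≤?_)
open import Data.Nat.Properties
open import Data.Nat.DivMod using (_%_; n%n≡0; m<n⇒m%n≡m)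
open import Data.Nat.Tactic.RingSolver using (solve-∀)
open import Data.Fin using (Fin; toℕ; fromℕ<; fromℕ; zero; suc; inject₁)
open import Data.Fin.Properties using (toℕ<n; toℕ-fromℕ<; toℕ-fromℕ; toℕ-injective; toℕ-inject₁)
open import Data.Product using (Σ; _×_; _,_; proj₁; proj₂)
open import Data.Sum using (_⊎_; inj₁; inj₂)
open import Data.Empty using (⊥; ⊥-elim)
open import Data.List using (List; []; _∷_; length)
open import Data.List.Membership.Propositional using (_∈_)
open import Data.List.Relation.Unary.Any using (here; there)
open import Data.List.Relation.Unary.All using ([]; _∷_)
open import Data.List.Relation.Unary.AllPairs using ([]; _∷_)
open import Data.List.Relation.Unary.Unique.Propositional using (Unique)
open import Relation.Binary.PropositionalEquality
open import Relation.Nullary using (¬_; Dec; yes; no; contradiction)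

module Walks (G : Graph) where

  _++ʷ_ : ∀ {x y z} → Walk G x y → Walk G y z → Walk G x z
  nil _    ++ʷ w′ = w′
  cons e w ++ʷ w′ = cons e (w ++ʷ w′)

  wlen-++ʷ : ∀ {x y z} (w : Walk G x y) (w′ : Walk G y z) →
             wlen G (w ++ʷ w′) ≡ wlen G w + wlen G w′
  wlen-++ʷ (nil _)    w′ = refl
  wlen-++ʷ (cons e w) w′ = cong suc (wlen-++ʷ w w′)

  onWalk-start : ∀ {x y} (w : Walk G x y) → OnWalk G x w
  onWalk-start (nil _)    = here-nil
  onWalk-start (cons e w) = here-cons e w

  onWalk-junction : ∀ {x y z} (w : Walk G x z) (w′ : Walk G z y) → OnWalk G z (w ++ʷ w′)
  onWalk-junction (nil _)    w′ = onWalk-start w′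
  onWalk-junction (cons e w) w′ = there e (w ++ʷ w′) (onWalk-junction w w′)

  splitAt : ∀ {x y z} (w : Walk G x y) → OnWalk G z w →
            Σ (Walk G x z) λ w₁ → Σ (Walk G z y) λ w₂ → wlen G w₁ + wlen G w₂ ≡ wlen G w
  splitAt (nil _)    here-nil            = nil _ , nil _ , refl
  splitAt (cons e w) (here-cons .e .w)   = nil _ , cons e w , refl
  splitAt (cons e w) (there .e .w on) with splitAt w on
  ... | w₁ , w₂ , eq = cons e w₁ , w₂ , cong suc eq

  module Reverse (E-sym : ∀ {x y} → E G x y → E G y x) where

    snoc : ∀ {x y z} → Walk G x y → E G y z → Walk G x z
    snoc (nil _)    e′ = cons e′ (nil _)
    snoc (cons e w) e′ = cons e (snoc w e′)

    wlen-snoc : ∀ {x y z} (w : Walk G x y) (e : E G y z) → wlen G (snoc w e) ≡ suc (wlen G w)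
    wlen-snoc (nil _)    e′ = refl
    wlen-snoc (cons e w) e′ = cong suc (wlen-snoc w e′)

    reverse : ∀ {x y} → Walk G x y → Walk G y x
    reverse (nil x)    = nil x
    reverse (cons e w) = snoc (reverse w) (E-sym e)

    wlen-reverse : ∀ {x y} (w : Walk G x y) → wlen G (reverse w) ≡ wlen G w
    wlen-reverse (nil x)    = refl
    wlen-reverse (cons e w) = trans (wlen-snoc (reverse w) (E-sym e)) (cong suc (wlen-reverse w))

-- A graph metric: a function vanishing on the diagonal, growing by at most one along each
-- edge, and realised by walks.  Such a d is exactly the graph distance.
record GraphMetric (G : Graph) : Set where
  field
    d        : V G → V G → ℕ
    d-refl   : ∀ x → d x x ≡ 0
    d-lip    : ∀ x {y z} → E G y z → d x z ≤ suc (d x y)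
    geodesic : ∀ x y → Σ (Walk G x y) λ w → wlen G w ≤ d x y

module Intervals {G : Graph} (M : GraphMetric G) where
  open GraphMetric M
  open Walks G

  d≤wlen : ∀ {x y} (w : Walk G x y) → d x y ≤ wlen G w
  d≤wlen {x} w = subst (λ t → d x _ ≤ t + wlen G w) (d-refl x) (grow w)
    where
    grow : ∀ {y z} (w : Walk G y z) → d x z ≤ d x y + wlen G w
    grow (nil _)    = m≤m+n _ 0
    grow (cons e w) = ≤-trans (grow w) (≤-trans (+-monoˡ-≤ (wlen G w) (d-lip x e))
                                                 (≤-reflexive (sym (+-suc _ _))))

  interval-sound : ∀ {u v z} → Interval G u v z → d u z + d z v ≤ d u v
  interval-sound {u} {v} (inj₁ refl) = ≤-reflexive (cong (_+ d u v) (d-refl u))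
  interval-sound {u} {v} (inj₂ (inj₁ refl)) =
    ≤-reflexive (trans (cong (d u v +_) (d-refl v)) (+-identityʳ _))
  interval-sound {u} {v} (inj₂ (inj₂ (w , shortest , on))) with splitAt w on
  ... | w₁ , w₂ , eq = ≤-trans (+-mono-≤ (d≤wlen w₁) (d≤wlen w₂))
                        (≤-trans (≤-reflexive eq)
                          (≤-trans (shortest (proj₁ (geodesic u v))) (proj₂ (geodesic u v))))

  interval-complete : ∀ {u v z} → d u z + d z v ≤ d u v → Interval G u v z
  interval-complete {u} {v} {z} h with geodesic u z | geodesic z v
  ... | w₁ , l₁ | w₂ , l₂ = inj₂ (inj₂ (w₁ ++ʷ w₂ , shortest , onWalk-junction w₁ w₂))
    where
    shortest : Shortest G (w₁ ++ʷ w₂)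
    shortest w = ≤-trans (≤-reflexive (wlen-++ʷ w₁ w₂))
                   (≤-trans (+-mono-≤ l₁ l₂) (≤-trans h (d≤wlen w)))

  convex-closed : ∀ {T : VSet G} → Convex G T → ∀ {u v} z → T u → T v →
                  d u z + d z v ≤ d u v → T z
  convex-closed cT z tu tv h = cT z (_ , _ , tu , tv , interval-complete h)

module _ {G H : Graph} where

  -- walk in both factors simultaneously; the shorter walk waits at its end
  zipʷ : ∀ {a b p q} → Walk G a b → Walk H p q → Walk (G ⊠ H) (a , p) (b , q)
  zipʷ (nil a)    (nil p)    = nil (a , p)
  zipʷ (nil a)    (cons e w) = cons (inj₁ (refl , e)) (zipʷ (nil a) w)
  zipʷ (cons e w) (nil p)    = cons (inj₂ (inj₁ (refl , e))) (zipʷ w (nil p))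
  zipʷ (cons e w) (cons e′ w′) = cons (inj₂ (inj₂ (e , e′))) (zipʷ w w′)

  wlen-zipʷ : ∀ {a b p q} (w : Walk G a b) (w′ : Walk H p q) →
              wlen (G ⊠ H) (zipʷ w w′) ≡ wlen G w ⊔ wlen H w′
  wlen-zipʷ (nil a)    (nil p)      = refl
  wlen-zipʷ (nil a)    (cons e w)   = cong suc (wlen-zipʷ (nil a) w)
  wlen-zipʷ (cons e w) (nil p)      = cong suc (trans (wlen-zipʷ w (nil p)) (⊔-identityʳ _))
  wlen-zipʷ (cons e w) (cons e′ w′) = cong suc (wlen-zipʷ w w′)

  _⊠ᵐ_ : GraphMetric G → GraphMetric H → GraphMetric (G ⊠ H)
  MG ⊠ᵐ MH = record { d = d ; d-refl = d-refl ; d-lip = d-lip ; geodesic = geodesic }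
    where
    module MG = GraphMetric MG
    module MH = GraphMetric MH

    d : V (G ⊠ H) → V (G ⊠ H) → ℕ
    d (g , h) (g′ , h′) = MG.d g g′ ⊔ MH.d h h′

    d-refl : ∀ x → d x x ≡ 0
    d-refl (g , h) = cong₂ _⊔_ (MG.d-refl g) (MH.d-refl h)

    d-lip : ∀ x {y z} → E (G ⊠ H) y z → d x z ≤ suc (d x y)
    d-lip (g , h) (inj₁ (refl , e))         = ⊔-mono-≤ (n≤1+n _) (MH.d-lip h e)
    d-lip (g , h) (inj₂ (inj₁ (refl , e)))  = ⊔-mono-≤ (MG.d-lip g e) (n≤1+n _)
    d-lip (g , h) (inj₂ (inj₂ (e , e′)))    = ⊔-mono-≤ (MG.d-lip g e) (MH.d-lip h e′)

    geodesic : ∀ x y → Σ (Walk (G ⊠ H) x y) λ w → wlen (G ⊠ H) w ≤ d x y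
    geodesic (g , h) (g′ , h′) with MG.geodesic g g′ | MH.geodesic h h′
    ... | w , l | w′ , l′ = zipʷ w w′ , subst (_≤ d (g , h) (g′ , h′)) (sym (wlen-zipʷ w w′)) (⊔-mono-≤ l l′)

module _ (G : Graph) where

  -- the empty set is convex, so it spans nothing
  no-empty-hull : V G → ¬ IsHullSet G []
  no-empty-hull v hull = hull v (λ _ → ⊥) (λ { z (_ , _ , () , _) }) (λ _ ())

  -- a single vertex is convex, since the only shortest walk from v to v is the trivial one
  singleton-convex : ∀ v → Convex G (_≡ v)
  singleton-convex v z (_ , _ , refl , refl , inj₁ z≡v) = z≡v
  singleton-convex v z (_ , _ , refl , refl , inj₂ (inj₁ z≡v)) = z≡v
  singleton-convex v z (_ , _ , refl , refl , inj₂ (inj₂ (nil _ , _ , here-nil))) = refl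
  singleton-convex v z (_ , _ , refl , refl , inj₂ (inj₂ (cons e w , shortest , _))) with shortest (nil v)
  ... | ()

  no-singleton-hull : ∀ {a b} → a ≢ b → ∀ v → ¬ IsHullSet G (v ∷ [])
  no-singleton-hull a≢b v hull =
    a≢b (trans (hull _ (_≡ v) (singleton-convex v) sub) (sym (hull _ (_≡ v) (singleton-convex v) sub)))
    where
    sub : ∀ w → w ∈ (v ∷ []) → w ≡ v
    sub w (here w≡v) = w≡v

∣n-1+n∣≡1 : ∀ n → ∣ n - suc n ∣ ≡ 1
∣n-1+n∣≡1 zero    = refl
∣n-1+n∣≡1 (suc n) = ∣n-1+n∣≡1 n

∣-∣-step : ∀ p a → ∣ p - suc a ∣ ≤ suc ∣ p - a ∣ × ∣ p - a ∣ ≤ suc ∣ p - suc a ∣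
∣-∣-step p a =
  ≤-trans (∣-∣-triangle p a (suc a)) (≤-reflexive (trans (cong (∣ p - a ∣ +_) (∣n-1+n∣≡1 a)) (+-comm _ 1))) ,
  ≤-trans (∣-∣-triangle p (suc a) a)
          (≤-reflexive (trans (cong (∣ p - suc a ∣ +_) (trans (∣-∣-comm (suc a) a) (∣n-1+n∣≡1 a))) (+-comm _ 1)))

1+m∸n≤1+[m∸n] : ∀ m n → suc m ∸ n ≤ suc (m ∸ n)
1+m∸n≤1+[m∸n] m       zero    = ≤-refl
1+m∸n≤1+[m∸n] zero    (suc n) = subst (_≤ 1) (sym (0∸n≡0 n)) z≤n
1+m∸n≤1+[m∸n] (suc m) (suc n) = 1+m∸n≤1+[m∸n] m n

difference : ∀ {m n} → m ≤ n → Σ ℕ λ d → m + d ≡ n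
difference {m} {n} le = n ∸ m , m+[n∸m]≡n le

∸-split : ∀ {a t N} → a ≤ t → t ≤ N → (t ∸ a) + (N ∸ t) ≡ N ∸ a
∸-split {a} {t} {N} a≤t t≤N = begin
  (t ∸ a) + (N ∸ t)           ≡⟨ sym (m+n∸n≡m _ a) ⟩
  (t ∸ a) + (N ∸ t) + a ∸ a   ≡⟨ cong (_∸ a) regroup ⟩
  N ∸ a                       ∎
  where
  open ≡-Reasoning
  regroup : (t ∸ a) + (N ∸ t) + a ≡ N
  regroup = begin
    (t ∸ a) + (N ∸ t) + a   ≡⟨ +-assoc (t ∸ a) _ a ⟩
    (t ∸ a) + ((N ∸ t) + a) ≡⟨ cong ((t ∸ a) +_) (+-comm (N ∸ t) a) ⟩
    (t ∸ a) + (a + (N ∸ t)) ≡⟨ sym (+-assoc (t ∸ a) a _) ⟩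
    (t ∸ a) + a + (N ∸ t)   ≡⟨ cong (_+ (N ∸ t)) (m∸n+n≡m a≤t) ⟩
    t + (N ∸ t)             ≡⟨ m+[n∸m]≡n t≤N ⟩
    N                       ∎

min+dist : ∀ a c → a ⊓ c + ∣ a - c ∣ ≡ a ⊔ c
min+dist a c with ≤-total a c
... | inj₁ a≤c with difference a≤c
...   | d , refl rewrite m≤n⇒m⊓n≡m a≤c | m≤n⇒m⊔n≡n a≤c = cong (a +_) (∣m-m+n∣≡n a d)
min+dist a c | inj₂ c≤a with difference c≤a
...   | d , refl rewrite m≥n⇒m⊓n≡n c≤a | m≥n⇒m⊔n≡m c≤a =
  cong (c +_) (trans (∣-∣-comm (c + d) c) (∣m-m+n∣≡n c d))

min+min+dist : ∀ a c → (a ⊓ c) + (a ⊓ c) + ∣ a - c ∣ ≡ a + c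
min+min+dist a c with ≤-total a c
... | inj₁ a≤c with difference a≤c
...   | d , refl rewrite m≤n⇒m⊓n≡m a≤c | ∣m-m+n∣≡n a d = +-assoc a a d
min+min+dist a c | inj₂ c≤a with difference c≤a
...   | d , refl rewrite m≥n⇒m⊓n≡n c≤a | ∣-∣-comm (c + d) c | ∣m-m+n∣≡n c d =
  trans (+-assoc c c d) (+-comm c (c + d))

sum+dist : ∀ a c → a + c + ∣ a - c ∣ ≡ (a ⊔ c) + (a ⊔ c)
sum+dist a c = begin
  a + c + ∣ a - c ∣                          ≡⟨ cong (_+ ∣ a - c ∣) (sym (min+min+dist a c)) ⟩
  (a ⊓ c) + (a ⊓ c) + ∣ a - c ∣ + ∣ a - c ∣   ≡⟨ regroup (a ⊓ c) ∣ a - c ∣ ⟩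
  (a ⊓ c + ∣ a - c ∣) + (a ⊓ c + ∣ a - c ∣)   ≡⟨ cong₂ _+_ (min+dist a c) (min+dist a c) ⟩
  (a ⊔ c) + (a ⊔ c)                          ∎
  where
  open ≡-Reasoning
  regroup : ∀ l d → l + l + d + d ≡ (l + d) + (l + d)
  regroup = solve-∀

∣-∣-shift : ∀ {x y} a b c → x ≡ a + b → y ≡ a + c → ∣ x - y ∣ ≡ ∣ b - c ∣
∣-∣-shift a b c refl refl = ∣m+n-m+o∣≡∣n-o∣ a b c

half : ∀ {a b} → a + a ≤ b + b → a ≤ b
half h = ≮⇒≥ λ b<a → <⇒≱ (+-mono-< b<a b<a) h

Betw : ℕ → ℕ → ℕ → Set
Betw a b c = (a ⊓ c ≤ b) × (b ≤ a ⊔ c)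

between : ∀ a b c → ∣ a - b ∣ + ∣ b - c ∣ ≤ ∣ a - c ∣ → Betw a b c
between a b c h = half (+-cancelʳ-≤ ∣ a - c ∣ _ _ lower) , half (+-cancelʳ-≤ ∣ a - c ∣ _ _ upper)
  where
  swap : ∀ b x y → (b + x) + (b + y) ≡ (b + b) + (x + y)
  swap = solve-∀
  lower : (a ⊓ c) + (a ⊓ c) + ∣ a - c ∣ ≤ b + b + ∣ a - c ∣
  lower = begin
    (a ⊓ c) + (a ⊓ c) + ∣ a - c ∣       ≡⟨ min+min+dist a c ⟩
    a + c                               ≤⟨ +-mono-≤ (m≤n+∣m-n∣ a b) (m≤n+∣n-m∣ c b) ⟩
    (b + ∣ a - b ∣) + (b + ∣ b - c ∣)   ≡⟨ swap b _ _ ⟩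
    (b + b) + (∣ a - b ∣ + ∣ b - c ∣)   ≤⟨ +-monoʳ-≤ (b + b) h ⟩
    b + b + ∣ a - c ∣                   ∎
    where open ≤-Reasoning
  upper : b + b + ∣ a - c ∣ ≤ (a ⊔ c) + (a ⊔ c) + ∣ a - c ∣
  upper = begin
    b + b + ∣ a - c ∣                           ≤⟨ +-monoˡ-≤ ∣ a - c ∣ (+-mono-≤ (m≤n+∣n-m∣ b a) (m≤n+∣m-n∣ b c)) ⟩
    (a + ∣ a - b ∣) + (c + ∣ b - c ∣) + ∣ a - c ∣ ≤⟨ +-monoˡ-≤ ∣ a - c ∣ (≤-reflexive (swap′ a c _ _)) ⟩
    (a + c) + (∣ a - b ∣ + ∣ b - c ∣) + ∣ a - c ∣ ≤⟨ +-monoˡ-≤ ∣ a - c ∣ (+-monoʳ-≤ (a + c) h) ⟩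
    (a + c) + ∣ a - c ∣ + ∣ a - c ∣             ≡⟨ cong (_+ ∣ a - c ∣) (sum+dist a c) ⟩
    (a ⊔ c) + (a ⊔ c) + ∣ a - c ∣               ∎
    where
    open ≤-Reasoning
    swap′ : ∀ a c x y → (a + x) + (c + y) ≡ (a + c) + (x + y)
    swap′ = solve-∀

betw-trans : ∀ {a c u v z} → Betw a u c → Betw a v c → Betw u z v → Betw a z c
betw-trans (l₁ , h₁) (l₂ , h₂) (l₃ , h₃) = ≤-trans (⊓-glb l₁ l₂) l₃ , ≤-trans h₃ (⊔-lub h₁ h₂)

betw-dist : ∀ {a c b b′} → Betw a b c → Betw a b′ c → ∣ b - b′ ∣ ≤ ∣ a - c ∣
betw-dist {a} {c} {b} {b′} (l , h) (l′ , h′) = +-cancelˡ-≤ (a ⊓ c) _ _ (begin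
    a ⊓ c + ∣ b - b′ ∣    ≤⟨ +-monoˡ-≤ ∣ b - b′ ∣ (⊓-glb l l′) ⟩
    b ⊓ b′ + ∣ b - b′ ∣   ≡⟨ min+dist b b′ ⟩
    b ⊔ b′                ≤⟨ ⊔-lub h h′ ⟩
    a ⊔ c                 ≡⟨ sym (min+dist a c) ⟩
    a ⊓ c + ∣ a - c ∣     ∎)
  where open ≤-Reasoning

K+K≢1 : ∀ {K} → K + K ≡ 1 → ⊥
K+K≢1 {zero}  ()
K+K≢1 {suc K} eq = 0≢1+n (sym (trans (sym (+-suc K K)) (suc-injective eq)))

∣-∣≡-view : ∀ a b {K} → ∣ a - b ∣ ≡ K → b ≡ a + K ⊎ a ≡ b + K
∣-∣≡-view a b refl with ≤-total a b
... | inj₁ a≤b = inj₁ (trans (sym (m+[n∸m]≡n a≤b)) (cong (a +_) (sym (m≤n⇒∣m-n∣≡n∸m a≤b))))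
... | inj₂ b≤a = inj₂ (trans (sym (m+[n∸m]≡n b≤a)) (cong (b +_) (sym (m≤n⇒∣n-m∣≡n∸m b≤a))))

no-line-triangle : ∀ a b c K → ∣ a - b ∣ ≡ K → ∣ a - c ∣ ≡ K → ∣ b - c ∣ ≡ 1 → ⊥
no-line-triangle a b c K ab ac bc with ∣-∣≡-view a b ab | ∣-∣≡-view a c ac
... | inj₁ refl | inj₁ refl = 0≢1+n (trans (sym (∣n-n∣≡0 (a + K))) bc)
... | inj₂ a≡b+K | inj₂ a≡c+K =
  0≢1+n (trans (sym (m≡n⇒∣m-n∣≡0 (+-cancelʳ-≡ K b c (trans (sym a≡b+K) a≡c+K)))) bc)
... | inj₁ refl | inj₂ refl =
  K+K≢1 {K} (trans (sym (trans (∣-∣-shift c (K + K) 0 (+-assoc c K K) (sym (+-identityʳ c))) (∣-∣-identityʳ (K + K)))) bc)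
... | inj₂ refl | inj₁ refl = K+K≢1 {K} (trans (sym (∣-∣-shift b 0 (K + K) (sym (+-identityʳ b)) (+-assoc b K K))) bc)

-- The strip ℕ × [0, M] with the L∞ distance, viewed in the diagonal coordinates
-- ξ₁ = s + j and ξ₂ = s + (M - j), in which it becomes half of the L¹ distance.
module Strip (M : ℕ) where

  Pt : Set
  Pt = ℕ × ℕ

  InStrip : Pt → Set
  InStrip (s , j) = j ≤ M

  D∞ : Pt → Pt → ℕ
  D∞ (s , j) (s′ , j′) = ∣ s - s′ ∣ ⊔ ∣ j - j′ ∣

  ξ₁ ξ₂ : Pt → ℕ
  ξ₁ (s , j) = s + j
  ξ₂ (s , j) = s + (M ∸ j)

  private
    tight : ∀ d t → d + t + ∣ t - d ∣ ≡ (d ⊔ t) + (d ⊔ t)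
    tight d t = trans (cong (d + t +_) (∣-∣-comm t d)) (sum+dist d t)

    ∸-cancel : ∀ j t e → j + t + e ∸ j ≡ t + e
    ∸-cancel j t e = trans (cong (_∸ j) (+-assoc j t e)) (m+n∸m≡n j (t + e))

    r₁ : ∀ s d j t → s + d + (j + t) ≡ s + j + (d + t)
    r₁ = solve-∀
    r₂ : ∀ s t e → s + (t + e) ≡ s + e + t
    r₂ = solve-∀
    r₃ : ∀ s d e → s + d + e ≡ s + e + d
    r₃ = solve-∀
    r₄ : ∀ s d j′ → s + d + j′ ≡ s + j′ + d
    r₄ = solve-∀
    r₅ : ∀ s d t e → s + d + (t + e) ≡ s + e + (d + t)
    r₅ = solve-∀

  diagonal-identity≤ : ∀ s s′ j j′ → s ≤ s′ → j ≤ M → j′ ≤ M →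
    ∣ (s + j) - (s′ + j′) ∣ + ∣ (s + (M ∸ j)) - (s′ + (M ∸ j′)) ∣ ≡ D∞ (s , j) (s′ , j′) + D∞ (s , j) (s′ , j′)
  diagonal-identity≤ s s′ j j′ s≤s′ j≤M j′≤M with difference s≤s′ | ≤-total j j′
  ... | d , refl | inj₁ j≤j′ with difference j≤j′ | difference j′≤M
  ...   | t , refl | e , refl = begin
    ∣ (s + j) - (s + d + (j + t)) ∣ + ∣ (s + (j + t + e ∸ j)) - (s + d + (j + t + e ∸ (j + t))) ∣
      ≡⟨ cong₂ _+_ (∣-∣-shift (s + j) 0 (d + t) (sym (+-identityʳ _)) (r₁ s d j t))
                   (∣-∣-shift (s + e) t d (trans (cong (s +_) (∸-cancel j t e)) (r₂ s t e))
                                          (trans (cong (s + d +_) (m+n∸m≡n (j + t) e)) (r₃ s d e))) ⟩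
    d + t + ∣ t - d ∣                  ≡⟨ tight d t ⟩
    (d ⊔ t) + (d ⊔ t)                  ≡⟨ cong (λ D → D + D) (sym (cong₂ _⊔_ (∣m-m+n∣≡n s d) (∣m-m+n∣≡n j t))) ⟩
    D∞ (s , j) (s + d , j + t) + D∞ (s , j) (s + d , j + t) ∎
    where open ≡-Reasoning
  diagonal-identity≤ s s′ j j′ s≤s′ j≤M j′≤M | d , refl | inj₂ j′≤j with difference j′≤j | difference j≤M
  ...   | t , refl | e , refl = begin
    ∣ (s + (j′ + t)) - (s + d + j′) ∣ + ∣ (s + (j′ + t + e ∸ (j′ + t))) - (s + d + (j′ + t + e ∸ j′)) ∣
      ≡⟨ cong₂ _+_ (∣-∣-shift (s + j′) t d (sym (+-assoc s j′ t)) (r₄ s d j′))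
                   (∣-∣-shift (s + e) 0 (d + t) (trans (cong (s +_) (m+n∸m≡n (j′ + t) e)) (sym (+-identityʳ _)))
                                                (trans (cong (s + d +_) (∸-cancel j′ t e)) (r₅ s d t e))) ⟩
    ∣ t - d ∣ + (d + t)                ≡⟨ trans (+-comm ∣ t - d ∣ _) (tight d t) ⟩
    (d ⊔ t) + (d ⊔ t)                  ≡⟨ cong (λ D → D + D) (sym (cong₂ _⊔_ (∣m-m+n∣≡n s d)
                                                                        (trans (∣-∣-comm (j′ + t) j′) (∣m-m+n∣≡n j′ t)))) ⟩
    D∞ (s , j′ + t) (s + d , j′) + D∞ (s , j′ + t) (s + d , j′) ∎
    where open ≡-Reasoning

  D∞-comm : ∀ p p′ → D∞ p p′ ≡ D∞ p′ p
  D∞-comm (s , j) (s′ , j′) = cong₂ _⊔_ (∣-∣-comm s s′) (∣-∣-comm j j′)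

  diagonal-identity : ∀ p p′ → InStrip p → InStrip p′ →
    ∣ ξ₁ p - ξ₁ p′ ∣ + ∣ ξ₂ p - ξ₂ p′ ∣ ≡ D∞ p p′ + D∞ p p′
  diagonal-identity (s , j) (s′ , j′) hj hj′ with ≤-total s s′
  ... | inj₁ s≤s′ = diagonal-identity≤ s s′ j j′ s≤s′ hj hj′
  ... | inj₂ s′≤s = trans (cong₂ _+_ (∣-∣-comm (s + j) _) (∣-∣-comm (s + (M ∸ j)) _))
                      (trans (diagonal-identity≤ s′ s j′ j s′≤s hj′ hj)
                             (cong (λ D → D + D) (D∞-comm (s′ , j′) (s , j))))

  -- the box spanned by p and q in diagonal coordinates, i.e. the L∞ interval I[p,q]
  record Box (p q r : Pt) : Set where
    constructor box
    field
      along₁ : Betw (ξ₁ p) (ξ₁ r) (ξ₁ q)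
      along₂ : Betw (ξ₂ p) (ξ₂ r) (ξ₂ q)

  box-corner : ∀ {p q} → Box p q p
  box-corner = box (m⊓n≤m _ _ , m≤m⊔n _ _) (m⊓n≤m _ _ , m≤m⊔n _ _)

  box-corner′ : ∀ {p q} → Box p q q
  box-corner′ = box (m⊓n≤n _ _ , m≤n⊔m _ _) (m⊓n≤n _ _ , m≤n⊔m _ _)

  box-trans : ∀ {p q u v z} → Box p q u → Box p q v → Box u v z → Box p q z
  box-trans (box u₁ u₂) (box v₁ v₂) (box z₁ z₂) = box (betw-trans u₁ v₁ z₁) (betw-trans u₂ v₂ z₂)

  interval⇒box : ∀ u v z → InStrip u → InStrip v → InStrip z →
                 D∞ u z + D∞ z v ≤ D∞ u v → Box u v z
  interval⇒box u v z hu hv hz h = box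
    (between _ _ _ (cancel total (∣-∣-triangle (ξ₂ u) (ξ₂ z) (ξ₂ v))))
    (between _ _ _ (cancel (subst₂ _≤_ (+-comm (A₁ + B₁) _) (+-comm Q₁ _) total) (∣-∣-triangle (ξ₁ u) (ξ₁ z) (ξ₁ v))))
    where
    A₁ A₂ B₁ B₂ Q₁ Q₂ : ℕ
    A₁ = ∣ ξ₁ u - ξ₁ z ∣
    A₂ = ∣ ξ₂ u - ξ₂ z ∣
    B₁ = ∣ ξ₁ z - ξ₁ v ∣
    B₂ = ∣ ξ₂ z - ξ₂ v ∣
    Q₁ = ∣ ξ₁ u - ξ₁ v ∣
    Q₂ = ∣ ξ₂ u - ξ₂ v ∣
    swap : ∀ a b c d → (a + b) + (c + d) ≡ (a + c) + (b + d)
    swap = solve-∀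
    -- both coordinates together are tight, so each one is
    total : (A₁ + B₁) + (A₂ + B₂) ≤ Q₁ + Q₂
    total = begin
      (A₁ + B₁) + (A₂ + B₂)                         ≡⟨ swap A₁ B₁ A₂ B₂ ⟩
      (A₁ + A₂) + (B₁ + B₂)                         ≡⟨ cong₂ _+_ (diagonal-identity u z hu hz) (diagonal-identity z v hz hv) ⟩
      (D∞ u z + D∞ u z) + (D∞ z v + D∞ z v)         ≡⟨ swap (D∞ u z) _ _ _ ⟩
      (D∞ u z + D∞ z v) + (D∞ u z + D∞ z v)         ≤⟨ +-mono-≤ h h ⟩
      D∞ u v + D∞ u v                               ≡⟨ sym (diagonal-identity u v hu hv) ⟩
      Q₁ + Q₂                                       ∎
      where open ≤-Reasoning
    cancel : ∀ {P₁ P₂ R₁ R₂} → P₁ + P₂ ≤ R₁ + R₂ → R₂ ≤ P₂ → P₁ ≤ R₁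
    cancel {P₁} {P₂} {R₁} h′ r = +-cancelʳ-≤ P₂ P₁ R₁ (≤-trans h′ (+-monoʳ-≤ R₁ r))

  box-narrow : ∀ {p q a b} → InStrip p → InStrip q → InStrip a → InStrip b →
               Box p q a → Box p q b → D∞ a b ≤ D∞ p q
  box-narrow {p} {q} {a} {b} hp hq ha hb (box a₁ a₂) (box b₁ b₂) = half (begin
    D∞ a b + D∞ a b                  ≡⟨ sym (diagonal-identity a b ha hb) ⟩
    ∣ ξ₁ a - ξ₁ b ∣ + ∣ ξ₂ a - ξ₂ b ∣ ≤⟨ +-mono-≤ (betw-dist a₁ b₁) (betw-dist a₂ b₂) ⟩
    ∣ ξ₁ p - ξ₁ q ∣ + ∣ ξ₂ p - ξ₂ q ∣ ≡⟨ diagonal-identity p q hp hq ⟩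
    D∞ p q + D∞ p q                  ∎)
    where open ≤-Reasoning

  _⇢_ : Pt → ℕ → Pt
  (s , j) ⇢ N = s + N , j

  D∞-⇢ : ∀ p q N → D∞ (p ⇢ N) (q ⇢ N) ≡ D∞ p q
  D∞-⇢ (s , j) (s′ , j′) N = cong (_⊔ ∣ j - j′ ∣) (∣-∣-shift N s s′ (+-comm s N) (+-comm s′ N))

  box-⇢ : ∀ {p q r} N → Box p q r → Box (p ⇢ N) (q ⇢ N) (r ⇢ N)
  box-⇢ {s , j} {s′ , j′} {s″ , j″} N (box b₁ b₂) =
    box (shift-betw (m+n+o≡m+o+n s N j) (m+n+o≡m+o+n s″ N j″) (m+n+o≡m+o+n s′ N j′) b₁)
        (shift-betw (m+n+o≡m+o+n s N _) (m+n+o≡m+o+n s″ N _) (m+n+o≡m+o+n s′ N _) b₂)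
    where
    m+n+o≡m+o+n : ∀ m n o → m + n + o ≡ m + o + n
    m+n+o≡m+o+n = solve-∀
    shift-betw : ∀ {a b c a′ b′ c′} → a′ ≡ a + N → b′ ≡ b + N → c′ ≡ c + N → Betw a b c → Betw a′ b′ c′
    shift-betw {a} {b} {c} refl refl refl (l , h) =
      subst (_≤ b + N) (+-distribʳ-⊓ N a c) (+-monoˡ-≤ N l) ,
      subst (b + N ≤_) (+-distribʳ-⊔ N a c) (+-monoˡ-≤ N h)

module Ascend {N : ℕ} (adj : Fin N → Fin N → Set)
              (succ-adj : ∀ {i j} → suc (toℕ i) ≡ toℕ j → adj i j) where

  G : Graph
  G = record { V = Fin N ; E = adj }

  ascend : (i j : Fin N) (d : ℕ) → toℕ i + d ≡ toℕ j →
           Σ (Walk G i j) λ w → wlen G w ≡ d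
  ascend i j zero eq = subst (λ t → Σ (Walk G i t) λ w → wlen G w ≡ 0)
                             (toℕ-injective (trans (sym (+-identityʳ _)) eq)) (nil i , refl)
  ascend i j (suc d) eq with ascend (fromℕ< next<N) j d (trans (cong (_+ d) (toℕ-fromℕ< next<N)) i+1+d≡)
    where
    i+1+d≡ : suc (toℕ i + d) ≡ toℕ j
    i+1+d≡ = trans (sym (+-suc _ d)) eq
    next<N : suc (toℕ i) < N
    next<N = ≤-<-trans (subst (suc (toℕ i) ≤_) i+1+d≡ (s≤s (m≤m+n _ d))) (toℕ<n j)
  ... | w , len = cons (succ-adj (sym (toℕ-fromℕ< _))) w , cong suc len

module PathMetric (m : ℕ) where

  private
    adj-sym : ∀ {i j} → PathAdj m i j → PathAdj m j i
    adj-sym (inj₁ e) = inj₂ e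
    adj-sym (inj₂ e) = inj₁ e

  open Ascend (PathAdj m) inj₁ using (ascend)
  open Walks.Reverse (Path m) adj-sym using (reverse; wlen-reverse)

  dP : Fin m → Fin m → ℕ
  dP p q = ∣ toℕ p - toℕ q ∣

  dP-lip : ∀ p {q q′} → PathAdj m q q′ → dP p q′ ≤ suc (dP p q)
  dP-lip p {q}      (inj₁ eq) =
    subst (λ t → ∣ toℕ p - t ∣ ≤ suc (dP p q)) eq (proj₁ (∣-∣-step (toℕ p) (toℕ q)))
  dP-lip p {q} {q′} (inj₂ eq) =
    subst (λ t → dP p q′ ≤ suc ∣ toℕ p - t ∣) eq (proj₂ (∣-∣-step (toℕ p) (toℕ q′)))

  upward : ∀ p q → toℕ p ≤ toℕ q → Σ (Walk (Path m) p q) λ w → wlen (Path m) w ≡ dP p q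
  upward p q le with ascend p q (toℕ q ∸ toℕ p) (m+[n∸m]≡n le)
  ... | w , len = w , trans len (sym (m≤n⇒∣m-n∣≡n∸m le))

  dP-geodesic : ∀ p q → Σ (Walk (Path m) p q) λ w → wlen (Path m) w ≤ dP p q
  dP-geodesic p q with ≤-total (toℕ p) (toℕ q)
  ... | inj₁ le = proj₁ (upward p q le) , ≤-reflexive (proj₂ (upward p q le))
  ... | inj₂ ge = reverse (proj₁ (upward q p ge)) ,
                  ≤-reflexive (trans (wlen-reverse _) (trans (proj₂ (upward q p ge)) (∣-∣-comm (toℕ q) (toℕ p))))

  pathMetric : GraphMetric (Path m)
  pathMetric = record { d = dP ; d-refl = λ p → ∣n-n∣≡0 (toℕ p) ; d-lip = dP-lip ; geodesic = dP-geodesic }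

module CycleMetric (k : ℕ) where

  n : ℕ
  n = suc (2 * k)

  f : ℕ → ℕ
  f Δ = Δ ⊓ (n ∸ Δ)

  dC : Fin n → Fin n → ℕ
  dC a b = f ∣ toℕ a - toℕ b ∣

  f-lip : ∀ {Δ Δ′} → Δ′ ≤ suc Δ → Δ ≤ suc Δ′ → f Δ′ ≤ suc (f Δ)
  f-lip {Δ} {Δ′} h h′ = ⊓-mono-≤ h (≤-trans (∸-monoʳ-≤ (suc n) h′) (1+m∸n≤1+[m∸n] n Δ))

  f-sym : ∀ {Δ} → Δ ≤ n → f (n ∸ Δ) ≡ f Δ
  f-sym {Δ} le = trans (cong ((n ∸ Δ) ⊓_) (m∸[m∸n]≡n le)) (⊓-comm (n ∸ Δ) Δ)

  top : Fin n
  top = fromℕ (2 * k)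

  succ-adj : ∀ {i j} → suc (toℕ i) ≡ toℕ j → CycleAdj n i j
  succ-adj {j = j} eq = inj₁ (trans (m<n⇒m%n≡m (subst (_< n) (sym eq) (toℕ<n j))) eq)

  wrap-adj : ∀ {i j} → toℕ i ≡ 2 * k → toℕ j ≡ 0 → CycleAdj n i j
  wrap-adj eqi eqj = inj₁ (trans (cong (λ t → suc t % n) eqi) (trans (n%n≡0 n) (sym eqj)))

  adj-sym : ∀ {i j} → CycleAdj n i j → CycleAdj n j i
  adj-sym (inj₁ e) = inj₂ e
  adj-sym (inj₂ e) = inj₁ e

  step-lip : ∀ x y y′ → x < n → y < n → suc y % n ≡ y′ →
             f ∣ x - y′ ∣ ≤ suc (f ∣ x - y ∣) × f ∣ x - y ∣ ≤ suc (f ∣ x - y′ ∣)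
  step-lip x y y′ x<n y<n eq with suc y <? n
  ... | yes y+1<n = subst (λ t → f ∣ x - t ∣ ≤ suc (f ∣ x - y ∣) × f ∣ x - y ∣ ≤ suc (f ∣ x - t ∣))
                          (trans (sym (m<n⇒m%n≡m y+1<n)) eq)
                          (f-lip (proj₁ (∣-∣-step x y)) (proj₂ (∣-∣-step x y)) ,
                           f-lip (proj₂ (∣-∣-step x y)) (proj₁ (∣-∣-step x y)))
  ... | no y+1≮n = subst₂ (λ s t → f ∣ x - t ∣ ≤ suc (f ∣ x - s ∣) × f ∣ x - s ∣ ≤ suc (f ∣ x - t ∣))
                          (sym y≡2k) y′≡0
                          (≤-trans (≤-reflexive fx≡) (f-lip n-x≤ x-2k≤) ,
                           subst (λ t → f ∣ x - 2 * k ∣ ≤ suc t) (sym fx≡) (f-lip x-2k≤ n-x≤))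
    where
    -- wrapping around: y = 2k and y′ = 0, and then n - x = 1 + ∣ x - 2k ∣ while f x = f (n - x)
    y+1≡n : suc y ≡ n
    y+1≡n = ≤-antisym y<n (≮⇒≥ y+1≮n)
    y≡2k : y ≡ 2 * k
    y≡2k = suc-injective y+1≡n
    y′≡0 : 0 ≡ y′
    y′≡0 = trans (sym (n%n≡0 n)) (trans (cong (_% n) (sym y+1≡n)) eq)
    x≤2k : x ≤ 2 * k
    x≤2k = ≤-pred x<n
    n-x≡1+∣x-2k∣ : n ∸ x ≡ suc ∣ x - 2 * k ∣
    n-x≡1+∣x-2k∣ = trans (+-∸-assoc 1 x≤2k) (cong suc (sym (m≤n⇒∣m-n∣≡n∸m x≤2k)))
    n-x≤ : n ∸ x ≤ suc ∣ x - 2 * k ∣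
    n-x≤ = ≤-reflexive n-x≡1+∣x-2k∣
    x-2k≤ : ∣ x - 2 * k ∣ ≤ suc (n ∸ x)
    x-2k≤ = ≤-trans (n≤1+n _) (≤-trans (≤-reflexive (sym n-x≡1+∣x-2k∣)) (n≤1+n _))
    fx≡ : f ∣ x - 0 ∣ ≡ f (n ∸ x)
    fx≡ = trans (cong f (∣-∣-identityʳ x)) (sym (f-sym (<⇒≤ x<n)))

  dC-lip : ∀ a {b b′} → CycleAdj n b b′ → dC a b′ ≤ suc (dC a b)
  dC-lip a {b} {b′} (inj₁ eq) = proj₁ (step-lip (toℕ a) (toℕ b) (toℕ b′) (toℕ<n a) (toℕ<n b) eq)
  dC-lip a {b} {b′} (inj₂ eq) = proj₂ (step-lip (toℕ a) (toℕ b′) (toℕ b) (toℕ<n a) (toℕ<n b′) eq)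

  open Ascend (CycleAdj n) succ-adj using (ascend)
  open Walks (Cycle n) using (_++ʷ_; wlen-++ʷ)
  open Walks.Reverse (Cycle n) adj-sym using (reverse; wlen-reverse)

  -- for a ≤ b there are two walks: straight up, of length b - a, and around through the
  -- edge top ~ zero, of length n - (b - a)
  module _ (a b : Fin n) (a≤b : toℕ a ≤ toℕ b) where

    straight : Σ (Walk (Cycle n) a b) λ w → wlen (Cycle n) w ≡ toℕ b ∸ toℕ a
    straight = ascend a b _ (m+[n∸m]≡n a≤b)

    around : Σ (Walk (Cycle n) a b) λ w → wlen (Cycle n) w ≡ n ∸ (toℕ b ∸ toℕ a)
    around = reverse down ++ʷ cons (adj-sym (wrap-adj (toℕ-fromℕ (2 * k)) refl)) (reverse up) , len
      where
      b≤2k : toℕ b ≤ 2 * k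
      b≤2k = ≤-pred (toℕ<n b)
      down : Walk (Cycle n) zero a
      down = proj₁ (ascend zero a (toℕ a) refl)
      up : Walk (Cycle n) b top
      up = proj₁ (ascend b top (2 * k ∸ toℕ b) (trans (m+[n∸m]≡n b≤2k) (sym (toℕ-fromℕ (2 * k)))))
      total : toℕ a + suc (2 * k ∸ toℕ b) + (toℕ b ∸ toℕ a) ≡ n
      total = begin
        toℕ a + suc (2 * k ∸ toℕ b) + (toℕ b ∸ toℕ a) ≡⟨ regroup (toℕ a) _ _ ⟩
        suc (2 * k ∸ toℕ b + (toℕ a + (toℕ b ∸ toℕ a))) ≡⟨ cong (λ t → suc (2 * k ∸ toℕ b + t)) (m+[n∸m]≡n a≤b) ⟩
        suc (2 * k ∸ toℕ b + toℕ b) ≡⟨ cong suc (m∸n+n≡m b≤2k) ⟩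
        n ∎
        where
        open ≡-Reasoning
        regroup : ∀ a c d → a + suc c + d ≡ suc (c + (a + d))
        regroup = solve-∀
      len : wlen (Cycle n) (reverse down ++ʷ cons _ (reverse up)) ≡ n ∸ (toℕ b ∸ toℕ a)
      len = begin
        wlen (Cycle n) (reverse down ++ʷ cons _ (reverse up)) ≡⟨ wlen-++ʷ (reverse down) _ ⟩
        wlen (Cycle n) (reverse down) + suc (wlen (Cycle n) (reverse up))
          ≡⟨ cong₂ (λ s t → s + suc t) (trans (wlen-reverse down) (proj₂ (ascend zero a (toℕ a) refl)))
                                       (trans (wlen-reverse up) (proj₂ (ascend b top _ _))) ⟩
        toℕ a + suc (2 * k ∸ toℕ b) ≡⟨ sym (m+n∸n≡m _ (toℕ b ∸ toℕ a)) ⟩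
        toℕ a + suc (2 * k ∸ toℕ b) + (toℕ b ∸ toℕ a) ∸ (toℕ b ∸ toℕ a) ≡⟨ cong (_∸ (toℕ b ∸ toℕ a)) total ⟩
        n ∸ (toℕ b ∸ toℕ a) ∎
        where open ≡-Reasoning

    shorter : Σ (Walk (Cycle n) a b) λ w → wlen (Cycle n) w ≤ dC a b
    shorter = subst (λ Δ → Σ (Walk (Cycle n) a b) λ w → wlen (Cycle n) w ≤ f Δ)
                    (sym (m≤n⇒∣m-n∣≡n∸m a≤b)) (pick (⊓-sel Δ (n ∸ Δ)))
      where
      Δ : ℕ
      Δ = toℕ b ∸ toℕ a
      pick : f Δ ≡ Δ ⊎ f Δ ≡ n ∸ Δ → Σ (Walk (Cycle n) a b) λ w → wlen (Cycle n) w ≤ f Δ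
      pick (inj₁ eq) = proj₁ straight , ≤-reflexive (trans (proj₂ straight) (sym eq))
      pick (inj₂ eq) = proj₁ around , ≤-reflexive (trans (proj₂ around) (sym eq))

  dC-comm : ∀ a b → dC a b ≡ dC b a
  dC-comm a b = cong f (∣-∣-comm (toℕ a) (toℕ b))

  dC-geodesic : ∀ a b → Σ (Walk (Cycle n) a b) λ w → wlen (Cycle n) w ≤ dC a b
  dC-geodesic a b with ≤-total (toℕ a) (toℕ b)
  ... | inj₁ le = shorter a b le
  ... | inj₂ ge with shorter b a ge
  ...   | w , len = reverse w , subst₂ _≤_ (sym (wlen-reverse w)) (dC-comm b a) len

  cycleMetric : GraphMetric (Cycle n)
  cycleMetric = record { d = dC ; d-refl = λ a → cong f (∣n-n∣≡0 (toℕ a)) ; d-lip = dC-lip ; geodesic = dC-geodesic }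

  f≤Δ : ∀ Δ → f Δ ≤ Δ
  f≤Δ Δ = m⊓n≤m Δ (n ∸ Δ)

  f≤n-Δ : ∀ Δ → f Δ ≤ n ∸ Δ
  f≤n-Δ Δ = m⊓n≤n Δ (n ∸ Δ)

  n∸k≡1+k : n ∸ k ≡ suc k
  n∸k≡1+k = trans (+-∸-assoc 1 (m≤m+n k _)) (cong suc (trans (cong (λ t → (k + t) ∸ k) (+-identityʳ k)) (m+n∸m≡n k k)))

  f-small : ∀ Δ → Δ ≤ k → f Δ ≡ Δ
  f-small Δ h = m≤n⇒m⊓n≡m (≤-trans h (≤-trans (n≤1+n k) (≤-trans (≤-reflexive (sym n∸k≡1+k)) (∸-monoʳ-≤ n h))))

  n∸1+k≡k : n ∸ suc k ≡ k
  n∸1+k≡k = suc-injective (trans (sym (+-∸-assoc 1 (s≤s (m≤m+n k _)))) n∸k≡1+k)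

  f-large : ∀ Δ → k < Δ → f Δ ≡ n ∸ Δ
  f-large Δ h = m≥n⇒m⊓n≡n (≤-trans (∸-monoʳ-≤ n h) (≤-trans (≤-reflexive n∸1+k≡k) (<⇒≤ h)))

  f≤k : ∀ Δ → f Δ ≤ k
  f≤k Δ with Δ ≤? k
  ... | yes le = ≤-trans (f≤Δ Δ) le
  ... | no gt = ≤-trans (f≤n-Δ Δ) (≤-trans (∸-monoʳ-≤ n (≰⇒> gt)) (≤-reflexive n∸1+k≡k))

  prev : Fin n → Fin n
  prev zero    = top
  prev (suc j) = inject₁ j

  next : Fin n → Fin n
  next i with suc (toℕ i) <? n
  ... | yes lt = fromℕ< lt
  ... | no _   = zero

  prev-view : ∀ i → suc (toℕ (prev i)) ≡ toℕ i ⊎ (toℕ i ≡ 0 × toℕ (prev i) ≡ 2 * k)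
  prev-view zero    = inj₂ (refl , toℕ-fromℕ (2 * k))
  prev-view (suc j) = inj₁ (cong suc (toℕ-inject₁ j))

  next-view : ∀ i → toℕ (next i) ≡ suc (toℕ i) ⊎ (toℕ i ≡ 2 * k × toℕ (next i) ≡ 0)
  next-view i with suc (toℕ i) <? n
  ... | yes lt = inj₁ (toℕ-fromℕ< lt)
  ... | no ¬lt = inj₂ (suc-injective (≤-antisym (toℕ<n i) (≮⇒≥ ¬lt)) , refl)

  prev-adj : ∀ i → CycleAdj n (prev i) i
  prev-adj i with prev-view i
  ... | inj₁ eq          = succ-adj eq
  ... | inj₂ (eq₀ , eq₁) = wrap-adj eq₁ eq₀

  next-adj : ∀ i → CycleAdj n i (next i)
  next-adj i with next-view i
  ... | inj₁ eq          = succ-adj (sym eq)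
  ... | inj₂ (eq₀ , eq₁) = wrap-adj eq₀ eq₁

  dC-adj : ∀ {a b} → CycleAdj n a b → dC a b ≤ 1
  dC-adj {a} e = subst (λ t → dC a _ ≤ suc t) (cong f (∣n-n∣≡0 (toℕ a))) (dC-lip a e)

  -- Cutting the cycle open at the vertex c: position of i counted from c.
  module CutAt (c : ℕ) (c<n : c < n) where

    unwrap : ℕ → ℕ
    unwrap t with c ≤? t
    ... | yes _ = t
    ... | no _  = t + n

    unwrap-view : ∀ t → (c ≤ t × unwrap t ≡ t) ⊎ (t < c × unwrap t ≡ t + n)
    unwrap-view t with c ≤? t
    ... | yes c≤t = inj₁ (c≤t , refl)
    ... | no c≰t  = inj₂ (≰⇒> c≰t , refl)

    σ : Fin n → ℕ
    σ i = unwrap (toℕ i) ∸ c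

    σ<n : ∀ i → σ i < n
    σ<n i with unwrap-view (toℕ i)
    ... | inj₁ (_ , eq) = subst (λ u → u ∸ c < n) (sym eq) (≤-<-trans (m∸n≤m _ c) (toℕ<n i))
    ... | inj₂ (t<c , eq) = subst (λ u → u ∸ c < n) (sym eq) (m<n+o⇒m∸n<o (toℕ i + n) c (+-monoˡ-< n t<c))

    c≤unwrap : ∀ t → c ≤ unwrap t
    c≤unwrap t with unwrap-view t
    ... | inj₁ (c≤t , eq) = subst (c ≤_) (sym eq) c≤t
    ... | inj₂ (_ , eq)   = subst (c ≤_) (sym eq) (≤-trans (<⇒≤ c<n) (m≤n+m n t))

    around-invariant : ∀ t t′ → t′ < t → t < n → f ∣ t - (t′ + n) ∣ ≡ f ∣ t - t′ ∣
    around-invariant t t′ t′<t t<n with difference (<⇒≤ t′<t)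
    ... | w , refl = begin
      f ∣ t′ + w - (t′ + n) ∣ ≡⟨ cong f (∣m+n-m+o∣≡∣n-o∣ t′ w n) ⟩
      f ∣ w - n ∣           ≡⟨ cong f (m≤n⇒∣m-n∣≡n∸m w≤n) ⟩
      f (n ∸ w)             ≡⟨ f-sym w≤n ⟩
      f w                   ≡⟨ cong f (sym (trans (∣-∣-comm (t′ + w) t′) (∣m-m+n∣≡n t′ w))) ⟩
      f ∣ t′ + w - t′ ∣     ∎
      where
      open ≡-Reasoning
      w≤n : w ≤ n
      w≤n = ≤-trans (m≤n+m w t′) (<⇒≤ t<n)

    σ-dC : ∀ i i′ → dC i i′ ≡ f ∣ σ i - σ i′ ∣
    σ-dC i i′ = sym (begin
      f ∣ (unwrap t ∸ c) - (unwrap t′ ∸ c) ∣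
        ≡⟨ cong f (sym (∣-∣-shift c _ _ (sym (m+[n∸m]≡n (c≤unwrap t))) (sym (m+[n∸m]≡n (c≤unwrap t′))))) ⟩
      f ∣ unwrap t - unwrap t′ ∣             ≡⟨ cases (unwrap-view t) (unwrap-view t′) ⟩
      f ∣ t - t′ ∣                           ∎)
      where
      open ≡-Reasoning
      t t′ : ℕ
      t = toℕ i
      t′ = toℕ i′
      cases : (c ≤ t × unwrap t ≡ t) ⊎ (t < c × unwrap t ≡ t + n) →
              (c ≤ t′ × unwrap t′ ≡ t′) ⊎ (t′ < c × unwrap t′ ≡ t′ + n) →
              f ∣ unwrap t - unwrap t′ ∣ ≡ f ∣ t - t′ ∣
      cases (inj₁ (_ , e)) (inj₁ (_ , e′)) = cong f (cong₂ ∣_-_∣ e e′)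
      cases (inj₂ (_ , e)) (inj₂ (_ , e′)) = cong f (∣-∣-shift n t t′ (trans e (+-comm t n)) (trans e′ (+-comm t′ n)))
      cases (inj₁ (c≤t , e)) (inj₂ (t′<c , e′)) =
        trans (cong f (cong₂ ∣_-_∣ e e′)) (around-invariant t t′ (<-≤-trans t′<c c≤t) (toℕ<n i))
      cases (inj₂ (t<c , e)) (inj₁ (c≤t′ , e′)) = begin
        f ∣ unwrap t - unwrap t′ ∣ ≡⟨ cong f (trans (cong₂ ∣_-_∣ e e′) (∣-∣-comm (t + n) t′)) ⟩
        f ∣ t′ - (t + n) ∣         ≡⟨ around-invariant t′ t (<-≤-trans t<c c≤t′) (toℕ<n i′) ⟩
        f ∣ t′ - t ∣               ≡⟨ cong f (∣-∣-comm t′ t) ⟩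
        f ∣ t - t′ ∣               ∎

  -- the cut that places a given vertex at position k, the middle of 0 .. 2k
  module CentredAt (a : Fin n) where

    cut : ℕ
    cut with k ≤? toℕ a
    ... | yes _ = toℕ a ∸ k
    ... | no _  = toℕ a + suc k

    cut<n : cut < n
    cut<n with k ≤? toℕ a
    ... | yes _  = ≤-<-trans (m∸n≤m (toℕ a) k) (toℕ<n a)
    ... | no a≱k = subst (toℕ a + suc k <_) (trans (+-suc k k) (cong (λ t → suc (k + t)) (sym (+-identityʳ k))))
                         (+-monoˡ-< (suc k) (≰⇒> a≱k))

    open CutAt cut cut<n public

    σ-centre : σ a ≡ k
    σ-centre with k ≤? toℕ a | unwrap-view (toℕ a)
    ... | yes k≤a | inj₁ (_ , eq) = trans (cong (_∸ (toℕ a ∸ k)) eq) (m∸[m∸n]≡n k≤a)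
    ... | yes k≤a | inj₂ (a<cut , _) = contradiction a<cut (≤⇒≯ (m∸n≤m (toℕ a) k))
    ... | no a≱k | inj₁ (cut≤a , _) = contradiction cut≤a (<⇒≱ (m<m+n (toℕ a) (s≤s z≤n)))
    ... | no a≱k | inj₂ (_ , eq) =
      trans (cong (_∸ (toℕ a + suc k)) eq) (trans ([m+n]∸[m+o]≡n∸o (toℕ a) n (suc k)) n∸1+k≡k)

  k+k<n : k + k < n
  k+k<n = s≤s (≤-reflexive (cong (k +_) (sym (+-identityʳ k))))

  -- a going-around distance n - D cannot be short when D itself is short
  cycle-too-short : ∀ {D E} → D ≤ n → (n ∸ D) + E ≤ k → D ≤ k + E → ⊥
  cycle-too-short {D} {E} D≤n h h′ = <⇒≱ k+k<n (begin
    n                   ≡⟨ sym (m∸n+n≡m D≤n) ⟩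
    (n ∸ D) + D         ≤⟨ +-monoʳ-≤ (n ∸ D) h′ ⟩
    (n ∸ D) + (k + E)   ≡⟨ regroup (n ∸ D) k E ⟩
    (n ∸ D) + E + k     ≤⟨ +-monoˡ-≤ k h ⟩
    k + k               ∎)
    where
    open ≤-Reasoning
    regroup : ∀ a b c → a + (b + c) ≡ a + c + b
    regroup = solve-∀

  orient : ∀ a b → k < ∣ a - b ∣ → a + k < b ⊎ b + k < a
  orient a b h with ≤-total a b
  ... | inj₁ a≤b = inj₁ (subst (a + k <_) (m+[n∸m]≡n a≤b) (+-monoʳ-< a (subst (k <_) (m≤n⇒∣m-n∣≡n∸m a≤b) h)))
  ... | inj₂ b≤a = inj₂ (subst (b + k <_) (m+[n∸m]≡n b≤a) (+-monoʳ-< b (subst (k <_) (m≤n⇒∣n-m∣≡n∸m b≤a) h)))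

  gap : ∀ {a b} → a + k < b → k < ∣ a - b ∣
  gap {a} {b} h = subst (k <_) (sym (m≤n⇒∣m-n∣≡n∸m a≤b))
                        (subst (_< b ∸ a) (m+n∸m≡n a k) (∸-monoˡ-< h (m≤m+n a k)))
    where
    a≤b : a ≤ b
    a≤b = ≤-trans (m≤m+n a k) (<⇒≤ h)

  wrapped : ∀ {a b} → a + k < b → b < n → f ∣ a - b ∣ ≡ ∣ (a + n) - b ∣
  wrapped {a} {b} h b<n = begin
    f ∣ a - b ∣     ≡⟨ f-large _ (gap h) ⟩
    n ∸ ∣ a - b ∣   ≡⟨ cong (n ∸_) (m≤n⇒∣m-n∣≡n∸m a≤b) ⟩
    n ∸ (b ∸ a)     ≡⟨ sym (trans (∣-∣-shift a n (b ∸ a) refl (sym (m+[n∸m]≡n a≤b)))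
                               (m≤n⇒∣n-m∣≡n∸m (≤-trans (m∸n≤m b a) (<⇒≤ b<n)))) ⟩
    ∣ (a + n) - b ∣ ∎
    where
    open ≡-Reasoning
    a≤b : a ≤ b
    a≤b = ≤-trans (m≤m+n a k) (<⇒≤ h)

module Board (k m : ℕ) (2≤k : 2 ≤ k) where
  open CycleMetric k public
  open PathMetric m public

  G : Graph
  G = Cycle n ⊠ Path m

  metric : GraphMetric G
  metric = cycleMetric ⊠ᵐ pathMetric

  open GraphMetric metric public using (d)
  open Intervals metric public using (interval-sound; convex-closed)

  4≤2k : 4 ≤ 2 * k
  4≤2k = *-monoʳ-≤ 2 2≤k

  1+[2k∸1]≡2k : suc (2 * k ∸ 1) ≡ 2 * k
  1+[2k∸1]≡2k = m+[n∸m]≡n (≤-trans (s≤s z≤n) 4≤2k)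

  2≤f : ∀ Δ → 2 ≤ Δ → Δ + 2 ≤ n → 2 ≤ f Δ
  2≤f Δ h h′ = ⊓-glb h (subst (_≤ n ∸ Δ) (m+n∸n≡m 2 Δ) (∸-monoˡ-≤ Δ (subst (_≤ n) (+-comm Δ 2) h′)))

  2≤f[2k∸1] : ∀ p → suc p ≡ 2 * k → 2 ≤ f p
  2≤f[2k∸1] p eq = 2≤f p (≤-pred (≤-trans (n≤1+n 3) (subst (4 ≤_) (sym eq) 4≤2k)))
                       (≤-reflexive (trans (+-comm p 2) (cong suc eq)))

  -- the two neighbours of a vertex are not adjacent (this needs n ≥ 5)
  prev-next-far : ∀ i → 2 ≤ dC (prev i) (next i)
  prev-next-far i with prev-view i | next-view i
  ... | inj₁ eqp | inj₁ eqn =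
    subst (λ t → 2 ≤ f ∣ toℕ (prev i) - t ∣) (sym (trans eqn (cong suc (sym eqp))))
      (subst (λ Δ → 2 ≤ f Δ) (sym (∣n-2+n∣≡2 (toℕ (prev i)))) (2≤f 2 ≤-refl (≤-trans 4≤2k (n≤1+n _))))
    where
    ∣n-2+n∣≡2 : ∀ p → ∣ p - suc (suc p) ∣ ≡ 2
    ∣n-2+n∣≡2 zero    = refl
    ∣n-2+n∣≡2 (suc p) = ∣n-2+n∣≡2 p
  ... | inj₁ eqp | inj₂ (eq2k , eq0) =
    subst (λ t → 2 ≤ f ∣ toℕ (prev i) - t ∣) (sym eq0)
      (subst (λ Δ → 2 ≤ f Δ) (sym (∣-∣-identityʳ _)) (2≤f[2k∸1] _ (trans eqp eq2k)))
  ... | inj₂ (eq0 , eq2k) | inj₁ eqn =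
    subst₂ (λ s t → 2 ≤ f ∣ s - t ∣) (sym eq2k) (sym (trans eqn (cong suc eq0)))
      (subst (λ Δ → 2 ≤ f Δ) (sym (m≤n⇒∣n-m∣≡n∸m (≤-trans (s≤s z≤n) 4≤2k))) (2≤f[2k∸1] _ 1+[2k∸1]≡2k))
  ... | inj₂ (eq0 , _) | inj₂ (eq2k , _) = contradiction (trans (sym eq0) eq2k) (<⇒≢ (≤-trans (s≤s z≤n) 4≤2k))

  dP-adj : ∀ {q q′} → PathAdj m q q′ → dP q q′ ≤ 1
  dP-adj {q} e = subst (λ t → dP q _ ≤ suc t) (∣n-n∣≡0 (toℕ q)) (dP-lip q e)

  between-neighbours : ∀ {T} → Convex G T → ∀ i {q q′} → T (prev i , q) → T (next i , q) →
                       dP q q′ ≤ 1 → T (i , q′)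
  between-neighbours cT i {q} {q′} tp tn h = convex-closed cT (i , q′) tp tn
    (≤-trans (+-mono-≤ (⊔-lub (dC-adj (prev-adj i)) h)
                       (⊔-lub (dC-adj (next-adj i)) (subst (_≤ 1) (∣-∣-comm (toℕ q) (toℕ q′)) h)))
             (≤-trans (prev-next-far i) (m≤m⊔n _ _)))

  FullRow : VSet G → Fin m → Set
  FullRow T q = ∀ i → T (i , q)

  -- a convex set containing a whole row is everything: rows spread to adjacent rows
  fill-board : ∀ {T} → Convex G T → ∀ {q} → FullRow T q → ∀ v → T v
  fill-board {T} cT {q} full (i , q′) = along (proj₁ (dP-geodesic q q′)) full i
    where
    along : ∀ {q q′} → Walk (Path m) q q′ → FullRow T q → FullRow T q′
    along (nil _)    F = F
    along (cons e w) F = along w (λ i → between-neighbours cT i (F (prev i)) (F (next i)) (dP-adj e))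

  d-row : ∀ a b q → d (a , q) (b , q) ≡ dC a b
  d-row a b q = trans (cong (dC a b ⊔_) (∣n-n∣≡0 (toℕ q))) (⊔-identityʳ _)

  within-row : ∀ {T} → Convex G T → ∀ {a b} i {q} → T (a , q) → T (b , q) →
               dC a i + dC i b ≤ dC a b → T (i , q)
  within-row cT {a} {b} i {q} ta tb h =
    convex-closed cT (i , q) ta tb (subst₂ _≤_ (sym (cong₂ _+_ (d-row a i q) (d-row i b q))) (sym (d-row a b q)) h)

  -- the cycle vertices k and k+1, the two vertices farthest from zero
  k<n : k < n
  k<n = s≤s (m≤m+n k _)

  1+k<n : suc k < n
  1+k<n = s≤s (m<m+n k (≤-trans (s≤s z≤n) (≤-trans 2≤k (m≤m+n k 0))))

  vk : Fin n
  vk = fromℕ< k<n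

  vk+1 : Fin n
  vk+1 = fromℕ< 1+k<n

  zero≢vk : zero ≢ vk
  zero≢vk eq = <⇒≢ (≤-trans (s≤s z≤n) 2≤k) (trans (cong toℕ eq) (toℕ-fromℕ< k<n))

  zero≢vk+1 : zero ≢ vk+1
  zero≢vk+1 eq = 0≢1+n (trans (cong toℕ eq) (toℕ-fromℕ< 1+k<n))

  vk≢vk+1 : vk ≢ vk+1
  vk≢vk+1 eq = <⇒≢ (n<1+n k) (trans (sym (toℕ-fromℕ< k<n)) (trans (cong toℕ eq) (toℕ-fromℕ< 1+k<n)))

  dC-0-k : dC zero vk ≡ k
  dC-0-k = trans (cong f (toℕ-fromℕ< k<n)) (f-small k ≤-refl)

  dC-k+1-0 : dC vk+1 zero ≡ k
  dC-k+1-0 = trans (cong f (toℕ-fromℕ< 1+k<n)) (trans (f-large (suc k) ≤-refl) n∸1+k≡k)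

  dC-k-k+1 : dC vk vk+1 ≡ 1
  dC-k-k+1 = trans (cong₂ (λ a b → f ∣ a - b ∣) (toℕ-fromℕ< k<n) (toℕ-fromℕ< 1+k<n))
                   (trans (cong f (∣n-1+n∣≡1 k)) (f-small 1 (≤-trans (s≤s z≤n) 2≤k)))

  dC-0-≤ : ∀ i → dC zero i ≤ toℕ i
  dC-0-≤ i = f≤Δ (toℕ i)

  dC-0-≤′ : ∀ i → dC i zero ≤ n ∸ toℕ i
  dC-0-≤′ i = ≤-trans (f≤n-Δ _) (≤-reflexive (cong (n ∸_) (∣-∣-identityʳ (toℕ i))))

  dC-k-≤ : ∀ i → dC i vk ≤ ∣ toℕ i - k ∣
  dC-k-≤ i = ≤-trans (f≤Δ _) (≤-reflexive (cong (∣ toℕ i -_∣) (toℕ-fromℕ< k<n)))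

  dC-k+1-≤ : ∀ i → dC vk+1 i ≤ ∣ suc k - toℕ i ∣
  dC-k+1-≤ i = ≤-trans (f≤Δ _) (≤-reflexive (cong (∣_- toℕ i ∣) (toℕ-fromℕ< 1+k<n)))

  on-arc : ∀ i → toℕ i ≤ k → dC zero i + dC i vk ≤ dC zero vk
  on-arc i t≤k = begin
    dC zero i + dC i vk       ≤⟨ +-mono-≤ (dC-0-≤ i) (≤-trans (dC-k-≤ i) (≤-reflexive (m≤n⇒∣m-n∣≡n∸m t≤k))) ⟩
    toℕ i + (k ∸ toℕ i)       ≡⟨ trans (m+[n∸m]≡n t≤k) (sym dC-0-k) ⟩
    dC zero vk                ∎
    where open ≤-Reasoning

  on-far-arc : ∀ i → k < toℕ i → dC vk+1 i + dC i zero ≤ dC vk+1 zero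
  on-far-arc i k<t = begin
    dC vk+1 i + dC i zero         ≤⟨ +-mono-≤ (≤-trans (dC-k+1-≤ i) (≤-reflexive (m≤n⇒∣m-n∣≡n∸m k<t))) (dC-0-≤′ i) ⟩
    (toℕ i ∸ suc k) + (n ∸ toℕ i) ≡⟨ ∸-split k<t (<⇒≤ (toℕ<n i)) ⟩
    n ∸ suc k                     ≡⟨ trans n∸1+k≡k (sym dC-k+1-0) ⟩
    dC vk+1 zero                  ∎
    where open ≤-Reasoning

  detour : ∀ i → dC zero i + dC i vk ≤ suc k
  detour i with toℕ i ≤? k
  ... | yes t≤k = ≤-trans (on-arc i t≤k) (≤-trans (≤-reflexive dC-0-k) (n≤1+n k))
  ... | no t≰k = begin
    dC zero i + dC i vk           ≤⟨ +-mono-≤ (≤-trans (≤-reflexive (dC-comm zero i)) (dC-0-≤′ i))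
                                              (≤-trans (dC-k-≤ i) (≤-reflexive (m≤n⇒∣n-m∣≡n∸m k≤t))) ⟩
    (n ∸ toℕ i) + (toℕ i ∸ k)     ≡⟨ +-comm (n ∸ toℕ i) _ ⟩
    (toℕ i ∸ k) + (n ∸ toℕ i)     ≡⟨ trans (∸-split k≤t (<⇒≤ (toℕ<n i))) n∸k≡1+k ⟩
    suc k                         ∎
    where
    open ≤-Reasoning
    k≤t : k ≤ toℕ i
    k≤t = <⇒≤ (≰⇒> t≰k)

  row-from-three : ∀ {T} → Convex G T → ∀ {q} → T (zero , q) → T (vk , q) → T (vk+1 , q) → FullRow T q
  row-from-three cT t0 tk tk+1 i with toℕ i ≤? k
  ... | yes t≤k = within-row cT i t0 tk (on-arc i t≤k)
  ... | no t≰k  = within-row cT i tk+1 t0 (on-far-arc i (≰⇒> t≰k))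

  three-in-a-row : Fin m → List (V G)
  three-in-a-row q = (zero , q) ∷ (vk , q) ∷ (vk+1 , q) ∷ []

  three-in-a-row-hull : ∀ q → IsHullSet G (three-in-a-row q)
  three-in-a-row-hull q v T cT sub =
    fill-board cT (row-from-three cT (sub _ (here refl)) (sub _ (there (here refl))) (sub _ (there (there (here refl))))) v

  columns-differ : ∀ {u v : V G} → proj₁ u ≢ proj₁ v → u ≢ v
  columns-differ i≢i′ eq = i≢i′ (cong proj₁ eq)

  two≤hull : Fin m → ∀ S → IsHullSet G S → 2 ≤ length S
  two≤hull q []          hull = ⊥-elim (no-empty-hull G (zero , q) hull)
  two≤hull q (v ∷ [])    hull = ⊥-elim (no-singleton-hull G (columns-differ {zero , q} {vk , q} zero≢vk) v hull)
  two≤hull q (_ ∷ _ ∷ _) _    = s≤s (s≤s z≤n)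

  prev-farther : ∀ i → k < toℕ i → suc (dC zero i) ≤ k → dC zero (prev i) ≡ suc (dC zero i)
  prev-farther i k<t h with prev-view i
  ... | inj₂ (t≡0 , _) = contradiction (subst (k <_) t≡0 k<t) λ ()
  ... | inj₁ eq = begin
    f p                 ≡⟨ f-large p k<p ⟩
    n ∸ p               ≡⟨ +-∸-assoc 1 (≤-pred (toℕ<n (prev i))) ⟩
    suc (n ∸ suc p)     ≡⟨ cong (λ s → suc (n ∸ s)) eq ⟩
    suc (n ∸ toℕ i)     ≡⟨ cong suc (sym (f-large (toℕ i) k<t)) ⟩
    suc (f (toℕ i))     ∎
    where
    open ≡-Reasoning
    p : ℕ
    p = toℕ (prev i)
    -- otherwise i would be at distance at least k from 0
    k<p : k < p
    k<p = ≰⇒> λ p≤k → <-irrefl refl (≤-trans (s≤s (≤-trans (≤-reflexive (sym n∸1+k≡k))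
            (≤-trans (∸-monoʳ-≤ n (s≤s p≤k)) (≤-reflexive (trans (cong (n ∸_) eq) (sym (f-large (toℕ i) k<t))))))) h)

  module TwoCorners (k+2≤m : k + 2 ≤ m) where

    L : ℕ
    L = m ∸ 1

    1+k≤L : suc k ≤ L
    1+k≤L = ∸-monoˡ-≤ 1 (subst (_≤ m) (+-comm k 2) k+2≤m)

    L<m : L < m
    L<m = subst (L <_) (m∸n+n≡m (≤-trans (s≤s z≤n) (≤-trans (m≤n+m 2 k) k+2≤m))) (subst (L <_) (+-comm 1 L) ≤-refl)

    0<m : 0 < m
    0<m = ≤-<-trans z≤n L<m

    first last : Fin m
    first = fromℕ< 0<m
    last  = fromℕ< L<m

    x y : V G
    x = zero , first
    y = vk , last

    module Fill {T : VSet G} (cT : Convex G T) (tx : T x) (ty : T y) where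

      from-interval : ∀ i q → dC zero i ≤ toℕ q → dC i vk + toℕ q ≤ L → T (i , q)
      from-interval i q h h′ = convex-closed cT (i , q) tx ty (begin
        (dC zero i ⊔ dP first q) + (dC i vk ⊔ dP q last)
          ≤⟨ +-mono-≤ (⊔-lub h (≤-reflexive (cong (∣_- toℕ q ∣) (toℕ-fromℕ< 0<m))))
                      (⊔-lub (subst (_≤ L ∸ toℕ q) (m+n∸n≡m _ (toℕ q)) (∸-monoˡ-≤ (toℕ q) h′))
                             (≤-reflexive (trans (cong (∣ toℕ q -_∣) (toℕ-fromℕ< L<m)) (m≤n⇒∣m-n∣≡n∸m t≤L)))) ⟩
        toℕ q + (L ∸ toℕ q)   ≡⟨ m+[n∸m]≡n t≤L ⟩
        L                     ≡⟨ sym (cong₂ ∣_-_∣ (toℕ-fromℕ< 0<m) (toℕ-fromℕ< L<m)) ⟩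
        dP first last         ≤⟨ m≤n⊔m _ _ ⟩
        dC zero vk ⊔ dP first last ∎)
        where
        open ≤-Reasoning
        t≤L : toℕ q ≤ L
        t≤L = m+n≤o⇒n≤o (dC i vk) h′

      -- every vertex lies in I[x,y] in the row given by its distance from 0
      on-diagonal : ∀ i q → dC zero i ≡ toℕ q → T (i , q)
      on-diagonal i q eq = from-interval i q (≤-reflexive eq)
        (≤-trans (≤-reflexive (trans (cong (dC i vk +_) (sym eq)) (+-comm _ (dC zero i))))
                 (≤-trans (detour i) 1+k≤L))

      below-diagonal : ∀ i q → toℕ i ≤ k → suc (toℕ i) ≡ toℕ q → T (i , q)
      below-diagonal i q t≤k eq = from-interval i q (≤-trans (f≤Δ (toℕ i)) (≤-trans (n≤1+n _) (≤-reflexive eq)))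
        (≤-trans (+-mono-≤ (≤-trans (dC-k-≤ i) (≤-reflexive (m≤n⇒∣m-n∣≡n∸m t≤k))) (≤-reflexive (sym eq)))
                 (≤-trans (≤-reflexive (trans (+-suc (k ∸ toℕ i) (toℕ i)) (cong suc (m∸n+n≡m t≤k)))) 1+k≤L))

      Cone : ℕ → Set
      Cone r = ∀ i q → toℕ q ≡ r → dC zero i ≤ r → T (i , q)

      cone : ∀ r → r ≤ k → Cone r
      cone zero    _     i q eq h = on-diagonal i q (trans (n≤0⇒n≡0 h) (sym eq))
      cone (suc r) 1+r≤k i q eq h = by-distance (m≤n⇒m<n∨m≡n h)
        where
        r<m : r < m
        r<m = ≤-trans (n≤1+n _) (subst (_< m) eq (toℕ<n q))
        below : Fin m
        below = fromℕ< r<m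
        IH : Cone r
        IH = cone r (≤-trans (n≤1+n r) 1+r≤k)

        -- strictly inside the cone: both neighbours lie in the cone one row below
        inner : ∀ j → suc (dC zero j) ≤ r → T (j , q)
        inner j h′ = between-neighbours cT j
          (IH (prev j) below (toℕ-fromℕ< r<m) (≤-trans (dC-lip zero (adj-sym (prev-adj j))) h′))
          (IH (next j) below (toℕ-fromℕ< r<m) (≤-trans (dC-lip zero (next-adj j)) h′))
          (≤-reflexive (trans (cong₂ ∣_-_∣ (toℕ-fromℕ< r<m) eq) (∣n-1+n∣≡1 r)))

        -- at distance r: on the arc 0..k the vertex is in I[x,y]; on the far arc it lies
        -- in the row between its predecessor (on the rim) and 0 (inside)
        at-r : dC zero i ≡ r → T (i , q)
        at-r d≡r with toℕ i ≤? k
        ... | yes t≤k = below-diagonal i q t≤k (trans (cong suc (trans (sym (f-small _ t≤k)) d≡r)) (sym eq))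
        ... | no t≰k = within-row cT i tp t0
                (≤-trans (+-mono-≤ (dC-adj (prev-adj i)) (≤-reflexive (trans (dC-comm i zero) d≡r)))
                         (≤-reflexive (sym (trans (dC-comm (prev i) zero) dC-prev))))
          where
          k<t : k < toℕ i
          k<t = ≰⇒> t≰k
          dC-prev : dC zero (prev i) ≡ suc r
          dC-prev = trans (prev-farther i k<t (subst (λ s → suc s ≤ k) (sym d≡r) 1+r≤k)) (cong suc d≡r)
          tp : T (prev i , q)
          tp = on-diagonal (prev i) q (trans dC-prev (sym eq))
          t0 : T (zero , q)
          t0 = inner zero (subst (1 ≤_) (trans (sym (f-large _ k<t)) d≡r) (m<n⇒0<n∸m (toℕ<n i)))

        by-distance : dC zero i < suc r ⊎ dC zero i ≡ suc r → T (i , q)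
        by-distance (inj₂ on-rim) = on-diagonal i q (trans on-rim (sym eq))
        by-distance (inj₁ (s≤s h′)) with m≤n⇒m<n∨m≡n h′
        ... | inj₁ inside = inner i inside
        ... | inj₂ d≡r    = at-r d≡r

      everything : ∀ v → T v
      everything = fill-board cT (λ i → cone k ≤-refl i middle (toℕ-fromℕ< k<m) (f≤k _))
        where
        k<m : k < m
        k<m = ≤-trans (m<m+n k (s≤s z≤n)) k+2≤m
        middle : Fin m
        middle = fromℕ< k<m

    corners-hull : IsHullSet G (x ∷ y ∷ [])
    corners-hull v T cT sub = Fill.everything cT (sub x (here refl)) (sub y (there (here refl))) v

    corners-hull-number : HullNumber G 2
    corners-hull-number = (x ∷ y ∷ [] , (columns-differ zero≢vk ∷ []) ∷ [] ∷ [] , refl , corners-hull) ,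
                          λ S _ hull → two≤hull first S hull

  -- If m ≤ k + 1, no two vertices x, y form a hull set: cut the cycle open with x in the
  -- middle, and take the box spanned by x and y in diagonal coordinates.
  module NoTwoPointHull (m≤1+k : m ≤ suc k) (x y : V G) where
    open CentredAt (proj₁ x)

    M : ℕ
    M = m ∸ 1

    open Strip M

    M≤k : M ≤ k
    M≤k = ∸-monoˡ-≤ 1 m≤1+k

    row≤M : ∀ (q : Fin m) → toℕ q ≤ M
    row≤M q = ≤-trans (<⇒≤pred (toℕ<n q)) (≤-reflexive (pred[m∸n]≡m∸[1+n] m 0))

    pt : V G → Pt
    pt (i , q) = σ i , toℕ q

    strip : ∀ z → InStrip (pt z)
    strip (i , q) = row≤M q

    T : VSet G
    T z = Box (pt x) (pt y) (pt z)

    -- x sits in the middle, so the box is at most k wide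
    width : D∞ (pt x) (pt y) ≤ k
    width = ⊔-lub (subst (λ s → ∣ s - σ (proj₁ y) ∣ ≤ k) (sym σ-centre) ∣k-σ∣≤k)
                  (≤-trans (∣m-n∣≤m⊔n (toℕ (proj₂ x)) (toℕ (proj₂ y)))
                           (⊔-lub (≤-trans (row≤M (proj₂ x)) M≤k) (≤-trans (row≤M (proj₂ y)) M≤k)))
      where
      ∣k-σ∣≤k : ∣ k - σ (proj₁ y) ∣ ≤ k
      ∣k-σ∣≤k with ≤-total k (σ (proj₁ y))
      ... | inj₁ k≤s = subst (_≤ k) (sym (m≤n⇒∣m-n∣≡n∸m k≤s))
                         (≤-trans (∸-monoˡ-≤ k (≤-pred (σ<n (proj₁ y))))
                                  (≤-reflexive (trans (m+n∸m≡n k (k + 0)) (+-identityʳ k))))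
      ... | inj₂ s≤k = subst (_≤ k) (sym (m≤n⇒∣n-m∣≡n∸m s≤k)) (m∸n≤m k (σ (proj₁ y)))

    narrow : ∀ {u v} → T u → T v → D∞ (pt u) (pt v) ≤ k
    narrow {u} {v} tu tv = ≤-trans (box-narrow (strip x) (strip y) (strip u) (strip v) tu tv) width

    d-cut : ∀ u w → d u w ≡ f ∣ σ (proj₁ u) - σ (proj₁ w) ∣ ⊔ ∣ toℕ (proj₂ u) - toℕ (proj₂ w) ∣
    d-cut u w = cong (_⊔ ∣ toℕ (proj₂ u) - toℕ (proj₂ w) ∣) (σ-dC (proj₁ u) (proj₁ w))

    d-near : ∀ u w → ∣ σ (proj₁ u) - σ (proj₁ w) ∣ ≤ k → d u w ≡ D∞ (pt u) (pt w)
    d-near u w h = trans (d-cut u w) (cong (_⊔ ∣ toℕ (proj₂ u) - toℕ (proj₂ w) ∣) (f-small _ h))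

    f≤d : ∀ u w → f ∣ σ (proj₁ u) - σ (proj₁ w) ∣ ≤ d u w
    f≤d u w = ≤-trans (m≤m⊔n _ ∣ toℕ (proj₂ u) - toℕ (proj₂ w) ∣) (≤-reflexive (sym (d-cut u w)))

    d-comm : ∀ u w → d u w ≡ d w u
    d-comm u w = cong₂ _⊔_ (dC-comm (proj₁ u) (proj₁ w)) (∣-∣-comm (toℕ (proj₂ u)) (toℕ (proj₂ w)))

    module OnGeodesic (u v z : V G) (tu : T u) (tv : T v) (h : d u z + d z v ≤ d u v) where
      su sv sz : ℕ
      su = σ (proj₁ u)
      sv = σ (proj₁ v)
      sz = σ (proj₁ z)

      uv-near : ∣ su - sv ∣ ≤ k
      uv-near = ≤-trans (m≤m⊔n _ _) (narrow tu tv)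

      -- no wrapping: z lies on an L∞ geodesic, hence in the box of u and v, hence in T
      near : ∣ su - sz ∣ ≤ k → ∣ sz - sv ∣ ≤ k → T z
      near uz zv = box-trans tu tv (interval⇒box (pt u) (pt v) (pt z) (strip u) (strip v) (strip z)
        (subst₂ _≤_ (cong₂ _+_ (d-near u z uz) (d-near z v zv)) (d-near u v uv-near) h))

      -- wrapping on one side only: the cycle would have length at most 2k
      one-far : k < ∣ su - sz ∣ → ∣ sz - sv ∣ ≤ k → ⊥
      one-far uz zv = cycle-too-short Du≤n
        (begin
          (n ∸ ∣ su - sz ∣) + ∣ sz - sv ∣   ≡⟨ sym (cong₂ _+_ (f-large _ uz) (f-small _ zv)) ⟩
          f ∣ su - sz ∣ + f ∣ sz - sv ∣     ≤⟨ +-mono-≤ (f≤d u z) (f≤d z v) ⟩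
          d u z + d z v                     ≤⟨ h ⟩
          d u v                             ≡⟨ d-near u v uv-near ⟩
          D∞ (pt u) (pt v)                  ≤⟨ narrow tu tv ⟩
          k                                 ∎)
        (≤-trans (∣-∣-triangle su sv sz) (+-mono-≤ uv-near (≤-reflexive (∣-∣-comm sv sz))))
        where
        open ≤-Reasoning
        Du≤n : ∣ su - sz ∣ ≤ n
        Du≤n = ≤-trans (∣m-n∣≤m⊔n su sz) (<⇒≤ (⊔-lub (σ<n (proj₁ u)) (σ<n (proj₁ z))))

      -- z more than k beyond u and v beyond z: then u and v are too far apart
      zigzag : su + k < sz → sz + k < sv → ⊥
      zigzag uz zv = <⇒≱ (gap (<-trans uz (≤-<-trans (m≤m+n sz k) zv))) uv-near

      -- z more than k above both: shifting u and v once around puts z in the shifted box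
      above-both : su + k < sz → sv + k < sz → ⊥
      above-both uz vz = <⇒≱ far bound
        where
        u′ v′ : Pt
        u′ = pt u ⇢ n
        v′ = pt v ⇢ n
        geodesic : D∞ u′ (pt z) + D∞ (pt z) v′ ≤ D∞ u′ v′
        geodesic = subst₂ _≤_
          (cong₂ _+_ (trans (d-cut u z) (cong (_⊔ _) (wrapped uz (σ<n (proj₁ z)))))
                     (trans (d-cut z v) (cong (_⊔ _) (trans (cong f (∣-∣-comm sz sv))
                                                      (trans (wrapped vz (σ<n (proj₁ z))) (∣-∣-comm (sv + n) sz))))))
          (trans (d-near u v uv-near) (sym (D∞-⇢ (pt u) (pt v) n))) h
        inside : Box (pt x ⇢ n) (pt y ⇢ n) (pt z)
        inside = box-trans (box-⇢ n tu) (box-⇢ n tv)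
                   (interval⇒box u′ v′ (pt z) (strip u) (strip v) (strip z) geodesic)
        bound : D∞ (pt x ⇢ n) (pt z) ≤ k
        bound = ≤-trans (box-narrow (strip x) (strip y) (strip x) (strip z) box-corner inside)
                        (≤-trans (≤-reflexive (D∞-⇢ (pt x) (pt y) n)) width)
        far : k < D∞ (pt x ⇢ n) (pt z)
        far = <-≤-trans (subst (λ t → k < ∣ t - sz ∣) (cong (_+ n) (sym σ-centre))
                          (subst (k <_) (∣-∣-comm sz (k + n))
                                 (gap (subst (sz + k <_) (+-comm n k) (+-monoˡ-< k (σ<n (proj₁ z)))))))
                        (m≤m⊔n _ _)

      -- z more than k below both: shifting z once around puts it in the box
      below-both : sz + k < su → sz + k < sv → ⊥
      below-both zu zv = <⇒≱ far bound
        where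
        z′ : Pt
        z′ = pt z ⇢ n
        geodesic : D∞ (pt u) z′ + D∞ z′ (pt v) ≤ D∞ (pt u) (pt v)
        geodesic = subst₂ _≤_
          (cong₂ _+_ (trans (d-cut u z) (cong (_⊔ _) (trans (cong f (∣-∣-comm su sz))
                                                      (trans (wrapped zu (σ<n (proj₁ u))) (∣-∣-comm (sz + n) su)))))
                     (trans (d-cut z v) (cong (_⊔ _) (wrapped zv (σ<n (proj₁ v))))))
          (d-near u v uv-near) h
        inside : Box (pt x) (pt y) z′
        inside = box-trans tu tv
                   (interval⇒box (pt u) (pt v) z′ (strip u) (strip v) (strip z) geodesic)
        bound : D∞ (pt x) z′ ≤ k
        bound = ≤-trans (box-narrow (strip x) (strip y) (strip x) (strip z) box-corner inside) width
        far : k < D∞ (pt x) z′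
        far = <-≤-trans (subst (λ t → k < ∣ t - (sz + n) ∣) (sym σ-centre)
                          (gap (<-≤-trans k+k<n (m≤n+m n sz))))
                        (m≤m⊔n _ _)

    -- every geodesic between members of T stays in T: the only non-wrapping case is `near`
    geodesic-closed : ∀ u v z → T u → T v → d u z + d z v ≤ d u v → T z
    geodesic-closed u v z tu tv h = by-cases (∣ su - sz ∣ ≤? k) (∣ sz - sv ∣ ≤? k)
      where
      open OnGeodesic u v z tu tv h
      module Reversed = OnGeodesic v u z tv tu
        (subst₂ _≤_ (trans (+-comm (d u z) _) (cong₂ _+_ (d-comm z v) (d-comm u z))) (d-comm u v) h)

      by-cases : Dec (∣ su - sz ∣ ≤ k) → Dec (∣ sz - sv ∣ ≤ k) → T z
      by-cases (yes uz) (yes zv) = near uz zv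
      by-cases (no uz)  (yes zv) = ⊥-elim (one-far (≰⇒> uz) zv)
      by-cases (yes uz) (no zv)  = ⊥-elim (Reversed.one-far (subst (k <_) (∣-∣-comm sz sv) (≰⇒> zv))
                                                            (subst (_≤ k) (∣-∣-comm su sz) uz))
      by-cases (no uz)  (no zv) with orient su sz (≰⇒> uz) | orient sz sv (≰⇒> zv)
      ... | inj₁ u<z | inj₁ z<v = ⊥-elim (zigzag u<z z<v)
      ... | inj₂ z<u | inj₂ v<z = ⊥-elim (Reversed.zigzag v<z z<u)
      ... | inj₁ u<z | inj₂ v<z = ⊥-elim (above-both u<z v<z)
      ... | inj₂ z<u | inj₁ z<v = ⊥-elim (below-both z<u z<v)

    convex : Convex G T
    convex z (u , v , tu , tv , I) = geodesic-closed u v z tu tv (interval-sound I)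

    -- inside T the cut-open positions measure cycle distances exactly, so T cannot contain the
    -- vertices 0, k, k+1 of one row: C_{2k+1} does not embed isometrically into a line
    not-everything : ¬ (∀ v → T v)
    not-everything all = no-line-triangle (σ zero) (σ vk) (σ vk+1) k
      (trans (on-line zero vk) dC-0-k)
      (trans (on-line zero vk+1) (trans (dC-comm zero vk+1) dC-k+1-0))
      (trans (on-line vk vk+1) dC-k-k+1)
      where
      q : Fin m
      q = proj₂ x
      on-line : ∀ i i′ → ∣ σ i - σ i′ ∣ ≡ dC i i′
      on-line i i′ = sym (trans (σ-dC i i′) (f-small _ (≤-trans (m≤m⊔n _ _) (narrow (all (i , q)) (all (i′ , q))))))

    no-hull : ¬ IsHullSet G (x ∷ y ∷ [])
    no-hull hull = not-everything λ v → hull v T convex members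
      where
      members : ∀ w → w ∈ (x ∷ y ∷ []) → T w
      members w (here refl)         = box-corner
      members w (there (here refl)) = box-corner′

  three-hull-number : m ≤ suc k → Fin m → HullNumber G 3
  three-hull-number m≤1+k q = (three-in-a-row q , distinct , refl , three-in-a-row-hull q) , three≤
    where
    distinct : Unique (three-in-a-row q)
    distinct = (columns-differ zero≢vk ∷ columns-differ zero≢vk+1 ∷ []) ∷ (columns-differ vk≢vk+1 ∷ []) ∷ [] ∷ []
    three≤ : ∀ S → Unique S → IsHullSet G S → 3 ≤ length S
    three≤ []              _ hull = contradiction (two≤hull q [] hull) λ ()
    three≤ (v ∷ [])        _ hull = contradiction (two≤hull q (v ∷ []) hull) λ { (s≤s ()) }
    three≤ (a ∷ b ∷ [])    _ hull = ⊥-elim (NoTwoPointHull.no-hull m≤1+k a b hull)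
    three≤ (_ ∷ _ ∷ _ ∷ _) _ _    = s≤s (s≤s (s≤s z≤n))

proposition10 : (k m : ℕ) → 2 ≤ k → 2 ≤ m →
    (k + 2 ≤ m → HullNumber (Cycle (suc (2 * k)) ⊠ Path m) 2)
    × (m ≤ k + 1 → HullNumber (Cycle (suc (2 * k)) ⊠ Path m) 3)
proposition10 k m 2≤k 2≤m =
  TwoCorners.corners-hull-number ,
  λ m≤k+1 → three-hull-number (subst (m ≤_) (+-comm k 1) m≤k+1) (fromℕ< (≤-trans (s≤s z≤n) 2≤m))
  where open Board k m 2≤k
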